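{- Nesting of a flat relation is expressible by a sparse equation algebra expression without using the $\nu$ operator: for every relation name $R$ of flat type $(0,\dots,0)$ of arity $k$ and every nesting $\nu_{i_1,\dots,i_p}$ with $i_1,\dots,i_p\in\{1,\dots,k\}$, there is an equation algebra expression $e$ in which $\nu$ does not occur and all of whose occurring equations are sparse, such that $e(B)=\nu_{i_1,\dots,i_p}(R^B)$ for every database $B$ over $\{R\}$.
   Context: Relation types: $0$ is a type; if $\tau_1,\dots,\tau_k$ are types then $(\tau_1,\dots,\tau_k)$ is a type. Relations of type $0$ on $D$ are elements of $D$; relations of type $(\tau_1,\dots,\tau_k)$ on $D$ are finite sets of $k$-tuples whose $i$-th components are relations of type $\tau_i$. A type is flat if of the form $(0,\dots,0)$. A database over a schema (finite set of relation names with types $\neq 0$) consists of a nonempty finite domain $D$ and a relation of the appropriate type for each name. Nested relational algebra: union, difference, cartesian product, projection, equality selection (possibly set equality of nested components), nesting and unnesting. For $R$ of type $(\tau_1,\dots,\tau_k)$, $\nu_{i_1,\dots,i_p}(R)$ is the set of tuples $(x_1,\dots,x_k,S)$ with $(x_1,\dots,x_k)\in R$ and $S=\{(y_{i_1},\dots,y_{i_p})\mid (y_1,\dots,y_k)\in R,\ y_j=x_j\ \forall j\notin\{i_1,\dots,i_p\}\}$. Unnesting $\mu_i(R)=\{(x_1,\dots,x_k,y_1,\dots,y_\ell)\mid (x_1,\dots,x_k)\in R,\ (y_1,\dots,y_\ell)\in x_i\}$. Expressions are built from relation names and the symbol $D$ for the domain. The equation algebra adds solution expressions $\{(X_1,\dots,X_p)\mid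 e_1=e_2\}$ ($e_1,e_2$ equation algebra expressions, $X_i$ distinct relation names that become bound), evaluating on a database $B$ with domain $D$ to the set of all $(X_1^A,\dots,X_p^A)$ with $A$ a database over $\{X_1,\dots,X_p\}$ with domain $D$ satisfying $e_1(B,A)=e_2(B,A)$. Such an equation is sparse if all $X_i$ have flat type and the number of solutions on any given database is at most polynomial in the size of the database. -}

module Defs where

open import Data.Nat using (ℕ; zero; suc; _+_; _*_; _^_; _≤_)
open import Data.Fin using (Fin; zero; suc)
import Data.Fin as F
open import Data.Bool using (Bool; true; false; _∧_; _∨_; not; T)
open import Data.List using (List; []; _∷_; _++_; map; length; lookup; concatMap; allFin; filterᵇ)
open import Data.Bool.ListAction using (all; any)
open import Data.Unit using (⊤; tt)
open import Data.Empty using (⊥)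
open import Data.Product using (_×_; _,_; Σ; ∃)
open import Data.List.Membership.Propositional using (_∈_)
open import Data.List.Relation.Unary.Any using (here; there)
open import Data.List.Relation.Unary.All using (All)
open import Relation.Binary.PropositionalEquality using (_≡_; refl; subst)
open import Relation.Nullary.Decidable using (⌊_⌋)

-- Relation types:  base = type 0,  tup (τ₁ ∷ … ∷ τₖ ∷ []) = (τ₁,…,τₖ)

data Ty : Set where
  base : Ty
  tup  : List Ty → Ty

Flat : List Ty → Set
Flat ts = All (_≡ base) ts

-- A schema (context) lists the types of the relation names; every name
-- has a type ≠ 0, i.e. a tuple type, so we record only its component list.
Ctx : Set
Ctx = List (List Ty)

-- An expression of index ts denotes a relation of type (tup ts).

data Expr : Ctx → List Ty → Set where
  var    : ∀ {Γ ts} → ts ∈ Γ → Expr Γ ts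
  dom    : ∀ {Γ} → Expr Γ (base ∷ [])
  _∪_    : ∀ {Γ ts} → Expr Γ ts → Expr Γ ts → Expr Γ ts
  _∖_    : ∀ {Γ ts} → Expr Γ ts → Expr Γ ts → Expr Γ ts
  _⊗_    : ∀ {Γ ts us} → Expr Γ ts → Expr Γ us → Expr Γ (ts ++ us)
  proj   : ∀ {Γ ts} (js : List (Fin (length ts))) → Expr Γ ts →
           Expr Γ (map (lookup ts) js)
  sel    : ∀ {Γ ts} (i j : Fin (length ts)) → lookup ts i ≡ lookup ts j →
           Expr Γ ts → Expr Γ ts
  nest   : ∀ {Γ ts} (is : List (Fin (length ts))) → Expr Γ ts →
           Expr Γ (ts ++ tup (map (lookup ts) is) ∷ [])
  unnest : ∀ {Γ ts us} (i : Fin (length ts)) → lookup ts i ≡ tup us →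
           Expr Γ ts → Expr Γ (ts ++ us)
  -- { (X₁,…,Xₚ) | e₁ = e₂ } : the new names X₁…Xₚ (types tup Xs) are bound
  sol    : ∀ {Γ σ} (Xs : Ctx) → Expr (Γ ++ Xs) σ → Expr (Γ ++ Xs) σ →
           Expr Γ (map tup Xs)

-- Semantics over the domain Fin N.  Finite sets are represented by lists;
-- set equality is the (decidable) mutual-inclusion relation eqV.

module Sem (N : ℕ) where

  mutual
    Val : Ty → Set
    Val base     = Fin N
    Val (tup ts) = List (Tup ts)

    Tup : List Ty → Set
    Tup []       = ⊤
    Tup (t ∷ ts) = Val t × Tup ts

  mutual
    eqV : (τ : Ty) → Val τ → Val τ → Bool
    eqV base a b = ⌊ a F.≟ b ⌋
    eqV (tup ts) xs ys = subT ts xs ys ∧ subT ts ys xs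

    eqT : (ts : List Ty) → Tup ts → Tup ts → Bool
    eqT [] _ _ = true
    eqT (t ∷ ts) (x , xs) (y , ys) = eqV t x y ∧ eqT ts xs ys

    memT : (ts : List Ty) → Tup ts → List (Tup ts) → Bool
    memT ts x [] = false
    memT ts x (y ∷ ys) = eqT ts x y ∨ memT ts x ys

    subT : (ts : List Ty) → List (Tup ts) → List (Tup ts) → Bool
    subT ts [] ys = true
    subT ts (x ∷ xs) ys = memT ts x ys ∧ subT ts xs ys

  sublists : {A : Set} → List A → List (List A)
  sublists [] = [] ∷ []
  sublists (x ∷ xs) = map (x ∷_) (sublists xs) ++ sublists xs

  mutual
    allV : (τ : Ty) → List (Val τ)
    allV base = allFin N
    allV (tup ts) = sublists (allT ts)

    allT : (ts : List Ty) → List (Tup ts)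
    allT [] = tt ∷ []
    allT (t ∷ ts) = concatMap (λ x → map (x ,_) (allT ts)) (allV t)

  appT : ∀ ts us → Tup ts → Tup us → Tup (ts ++ us)
  appT [] us _ y = y
  appT (t ∷ ts) us (x , xs) y = x , appT ts us xs y

  lookupT : ∀ ts → Tup ts → (i : Fin (length ts)) → Val (lookup ts i)
  lookupT (t ∷ ts) (x , xs) zero = x
  lookupT (t ∷ ts) (x , xs) (suc i) = lookupT ts xs i

  projT : ∀ ts (js : List (Fin (length ts))) → Tup ts → Tup (map (lookup ts) js)
  projT ts [] x = tt
  projT ts (j ∷ js) x = lookupT ts x j , projT ts js x

  agree : ∀ ts (is : List (Fin (length ts))) → Tup ts → Tup ts → Bool
  agree ts is x y =
    all (λ j → any (λ i → ⌊ i F.≟ j ⌋) is ∨ eqV (lookup ts j) (lookupT ts x j) (lookupT ts y j))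
        (allFin (length ts))

  nestR : ∀ ts (is : List (Fin (length ts))) → List (Tup ts) →
          List (Tup (ts ++ tup (map (lookup ts) is) ∷ []))
  nestR ts is R =
    map (λ x → appT ts (tup (map (lookup ts) is) ∷ []) x
                 (map (projT ts is) (filterᵇ (agree ts is x) R) , tt)) R

  Env : Ctx → Set
  Env Γ = Tup (map tup Γ)

  appEnv : ∀ Γ Δ → Env Γ → Env Δ → Env (Γ ++ Δ)
  appEnv [] Δ _ ρ = ρ
  appEnv (u ∷ Γ) Δ (r , ρ) σ = r , appEnv Γ Δ ρ σ

  lookupEnv : ∀ {Γ ts} → ts ∈ Γ → Env Γ → List (Tup ts)
  lookupEnv (here refl) (r , _) = r
  lookupEnv (there x) (_ , ρ) = lookupEnv x ρ

  ⟦_⟧ : ∀ {Γ ts} → Expr Γ ts → Env Γ → List (Tup ts)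
  ⟦ var x ⟧ ρ = lookupEnv x ρ
  ⟦ dom ⟧ ρ = map (λ a → a , tt) (allFin N)
  ⟦ e ∪ f ⟧ ρ = ⟦ e ⟧ ρ ++ ⟦ f ⟧ ρ
  ⟦ _∖_ {ts = ts} e f ⟧ ρ = filterᵇ (λ x → not (memT ts x (⟦ f ⟧ ρ))) (⟦ e ⟧ ρ)
  ⟦ _⊗_ {ts = ts} {us} e f ⟧ ρ =
    concatMap (λ x → map (appT ts us x) (⟦ f ⟧ ρ)) (⟦ e ⟧ ρ)
  ⟦ proj {ts = ts} js e ⟧ ρ = map (projT ts js) (⟦ e ⟧ ρ)
  ⟦ sel {ts = ts} i j p e ⟧ ρ =
    filterᵇ (λ x → eqV (lookup ts j) (subst Val p (lookupT ts x i)) (lookupT ts x j)) (⟦ e ⟧ ρ)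
  ⟦ nest {ts = ts} is e ⟧ ρ = nestR ts is (⟦ e ⟧ ρ)
  ⟦ unnest {ts = ts} {us} i p e ⟧ ρ =
    concatMap (λ x → map (appT ts us x) (subst Val p (lookupT ts x i))) (⟦ e ⟧ ρ)
  ⟦ sol {Γ = Γ} {σ} Xs e f ⟧ ρ =
    filterᵇ (λ A → eqV (tup σ) (⟦ e ⟧ (appEnv Γ Xs ρ A)) (⟦ f ⟧ (appEnv Γ Xs ρ A)))
            (allT (map tup Xs))

  mutual
    sizeV : (τ : Ty) → Val τ → ℕ
    sizeV base _ = 1
    sizeV (tup ts) xs = sizeL ts xs

    sizeL : (ts : List Ty) → List (Tup ts) → ℕ
    sizeL ts [] = 0
    sizeL ts (x ∷ xs) = suc (sizeT ts x) + sizeL ts xs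

    sizeT : (ts : List Ty) → Tup ts → ℕ
    sizeT [] _ = 0
    sizeT (t ∷ ts) (x , xs) = sizeV t x + sizeT ts xs

  dbSize : ∀ Γ → Env Γ → ℕ
  dbSize Γ ρ = N + sizeT (map tup Γ) ρ

open Sem public

Sparse : ∀ {Γ σ} (Xs : Ctx) → Expr (Γ ++ Xs) σ → Expr (Γ ++ Xs) σ → Set
Sparse {Γ} Xs e f =
  All Flat Xs ×
  ∃ λ c → ∃ λ d → ∀ n (ρ : Env (suc n) Γ) →
    length (⟦_⟧ (suc n) (sol Xs e f) ρ) ≤ c * dbSize (suc n) Γ ρ ^ d

AllSparse : ∀ {Γ ts} → Expr Γ ts → Set
AllSparse (var x) = ⊤
AllSparse dom = ⊤
AllSparse (e ∪ f) = AllSparse e × AllSparse f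
AllSparse (e ∖ f) = AllSparse e × AllSparse f
AllSparse (e ⊗ f) = AllSparse e × AllSparse f
AllSparse (proj js e) = AllSparse e
AllSparse (sel i j p e) = AllSparse e
AllSparse (nest is e) = AllSparse e
AllSparse (unnest i p e) = AllSparse e
AllSparse (sol Xs e f) = Sparse Xs e f × AllSparse e × AllSparse f

NoNest : ∀ {Γ ts} → Expr Γ ts → Set
NoNest (var x) = ⊤
NoNest dom = ⊤
NoNest (e ∪ f) = NoNest e × NoNest f
NoNest (e ∖ f) = NoNest e × NoNest f
NoNest (e ⊗ f) = NoNest e × NoNest f
NoNest (proj js e) = NoNest e
NoNest (sel i j p e) = NoNest e
NoNest (nest is e) = ⊥
NoNest (unnest i p e) = NoNest e
NoNest (sol Xs e f) = NoNest e × NoNest f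

{-# OPTIONS --safe #-}
-- For a tuple x of R let S_x be its group: the projections on the columns is of the tuples of R
-- that agree with x outside is, so that ν(R) = {(x, S_x) | x ∈ R}. With two unknown flat relations
-- Y and S, one equation says that Y is a singleton {x} with x ∈ R and that S = π_is(σ(Y × R)),
-- σ selecting agreement outside is; being a conjunction of inclusions, it can be phrased as the
-- emptiness of a 0-ary relation collecting their violations. Its solutions are exactly the pairs
-- ({x}, S_x) for x ∈ R, so unnesting Y and reordering the columns yields ν(R). There are at most
-- |R| solutions, because relations are enumerated as ordered sublists of a duplicate-free list and
-- are therefore determined by their members; hence the equation is sparse.
module Submission where

open import Defs
open import Data.Nat using (ℕ; zero; suc; _+_; _*_; _^_; _≤_; z≤n; s≤s)
open import Data.Nat.Properties using (module ≤-Reasoning; ≤-trans; +-suc; m≤n+m; m≤m+n; *-identityˡ; ^-identityʳ)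
open import Data.Fin using (Fin; zero; suc)
import Data.Fin as F
open import Data.Bool using (Bool; true; false; T; _∨_; not; T?)
open import Data.Bool.Properties using (T-∧; T-∨)
open import Data.List
  using (List; []; _∷_; _++_; map; length; lookup; concatMap; filter; filterᵇ; allFin; cartesianProduct; cartesianProductWith)
open import Data.Bool.ListAction using (any)
open import Data.List.Properties
  using (length-map; length-++; filter-accept; filter-reject; map-id; map-∘; map-cong; ++-conicalˡ; ++-conicalʳ)
open import Data.List.Membership.Propositional using (_∈_; find; lose)
open import Data.List.Membership.Propositional.Properties
  using (∈-lookup; ∈-allFin; ∈-map⁺; ∈-map⁻; ∈-++⁺ˡ; ∈-++⁺ʳ; ∈-++⁻; ∈-∃++; ∈-filter⁺; ∈-filter⁻; ∈-concatMap⁺; ∈-concatMap⁻;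
         ∈-cartesianProduct⁺; ∈-cartesianProduct⁻; ∈-cartesianProductWith⁺; ∈-cartesianProductWith⁻)
open import Data.List.Relation.Binary.BagAndSetEquality using (_∼[_]_; set) renaming (map-cong to map-∼)
open import Data.List.Relation.Binary.Subset.Propositional using (_⊆_)
open import Data.List.Relation.Unary.Any as Any using (Any; here; there)
open import Data.List.Relation.Unary.Any.Properties using (lookup-index)
open import Data.List.Relation.Unary.All as All using (All; []; _∷_)
open import Data.List.Relation.Unary.All.Properties using (all⁺; all⁻) renaming (++⁺ to All++⁺; map⁺ to All-map⁺)
open import Data.List.Relation.Unary.AllPairs using ([]; _∷_)
open import Data.List.Relation.Unary.Unique.Propositional using (Unique)
import Data.List.Relation.Unary.Unique.Propositional.Properties as Unique
open import Data.Product using (Σ; ∃; ∃₂; _×_; _,_; proj₁; proj₂)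
open import Data.Product.Function.NonDependent.Propositional using (_×-⇔_)
open import Data.Sum using (inj₁; inj₂; [_,_]′)
open import Data.Unit using (tt)
open import Data.Empty using (⊥-elim)
open import Function using (_∘_; _⇔_; mk⇔; case_of_)
open import Function.Bundles using (Equivalence)
import Function.Properties.Equivalence as ⇔
open Equivalence using (to; from)
open import Relation.Nullary using (¬_; contradiction; does)
open import Relation.Nullary.Decidable using (⌊_⌋; toWitness; fromWitness)
open import Relation.Unary using (Pred; Decidable)
open import Relation.Binary.PropositionalEquality using (_≡_; refl; sym; trans; cong; cong₂; subst; module ≡-Reasoning)

module _ {A : Set} where

  Unique∧⊆⇒length≤ : ∀ {xs ys : List A} → Unique xs → xs ⊆ ys → length xs ≤ length ys
  Unique∧⊆⇒length≤ {[]} _ _ = z≤n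
  Unique∧⊆⇒length≤ {x ∷ xs} (x∉xs ∷ xs!) xs⊆ys with ∈-∃++ (xs⊆ys (here refl))
  ... | ys₁ , ys₂ , refl = subst (suc (length xs) ≤_) (sym length-removed)
        (s≤s (Unique∧⊆⇒length≤ xs! xs⊆ys₁++ys₂))
    where
    length-removed : length (ys₁ ++ x ∷ ys₂) ≡ suc (length (ys₁ ++ ys₂))
    length-removed = trans (length-++ ys₁) (trans (+-suc (length ys₁) (length ys₂)) (cong suc (sym (length-++ ys₁))))
    xs⊆ys₁++ys₂ : xs ⊆ ys₁ ++ ys₂
    xs⊆ys₁++ys₂ {z} z∈xs with ∈-++⁻ ys₁ (xs⊆ys (there z∈xs))
    ... | inj₁ z∈ys₁ = ∈-++⁺ˡ z∈ys₁
    ... | inj₂ (here refl) = contradiction refl (All.lookup x∉xs z∈xs)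
    ... | inj₂ (there z∈ys₂) = ∈-++⁺ʳ ys₁ z∈ys₂

module _ {A B C : Set} where

  concatMap-map≡cartesianProductWith : (f : A → B → C) (xs : List A) (ys : List B) →
    concatMap (λ x → map (f x) ys) xs ≡ cartesianProductWith f xs ys
  concatMap-map≡cartesianProductWith f [] ys = refl
  concatMap-map≡cartesianProductWith f (x ∷ xs) ys =
    cong (map (f x) ys ++_) (concatMap-map≡cartesianProductWith f xs ys)

module _ {A : Set} where

  filterᵇ-not≡[]⇔ : (p : A → Bool) (xs : List A) → filterᵇ (not ∘ p) xs ≡ [] ⇔ All (T ∘ p) xs
  filterᵇ-not≡[]⇔ p [] = mk⇔ (λ _ → []) (λ _ → refl)
  filterᵇ-not≡[]⇔ p (x ∷ xs) with p x in px≡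
  ... | true = mk⇔ (λ e → subst T (sym px≡) tt ∷ to (filterᵇ-not≡[]⇔ p xs) e)
                   (λ { (_ ∷ ps) → from (filterᵇ-not≡[]⇔ p xs) ps })
  ... | false = mk⇔ (λ ()) (λ { (px ∷ _) → ⊥-elim (subst T px≡ px) })

module _ {N : ℕ} {A : Set} where

  ∈-sublists⁻ : ∀ {xs ys : List A} → ys ∈ sublists N xs → ys ⊆ xs
  ∈-sublists⁻ {[]} (here refl) ()
  ∈-sublists⁻ {x ∷ xs} ys∈ z∈ys with ∈-++⁻ (map (x ∷_) (sublists N xs)) ys∈
  ... | inj₂ ys∈′ = there (∈-sublists⁻ ys∈′ z∈ys)
  ... | inj₁ ys∈′ with ∈-map⁻ (x ∷_) ys∈′ | z∈ys
  ...   | zs , zs∈ , refl | here refl = here refl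
  ...   | zs , zs∈ , refl | there z∈zs = there (∈-sublists⁻ zs∈ z∈zs)

  filter∈sublists : ∀ {p} {P : Pred A p} (P? : Decidable P) (xs : List A) → filter P? xs ∈ sublists N xs
  filter∈sublists P? [] = here refl
  filter∈sublists P? (x ∷ xs) with does (P? x)
  ... | true = ∈-++⁺ˡ (∈-map⁺ (x ∷_) (filter∈sublists P? xs))
  ... | false = ∈-++⁺ʳ (map (x ∷_) (sublists N xs)) (filter∈sublists P? xs)

  sublists⁺ : ∀ {xs : List A} → Unique xs → Unique (sublists N xs)
  sublists⁺ {[]} _ = [] ∷ []
  sublists⁺ {x ∷ xs} (x∉xs ∷ xs!) =
    Unique.++⁺ (Unique.map⁺ ∷-injectiveʳ (sublists⁺ xs!)) (sublists⁺ xs!) disjoint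
    where
    ∷-injectiveʳ : ∀ {ys zs : List A} → x ∷ ys ≡ x ∷ zs → ys ≡ zs
    ∷-injectiveʳ refl = refl
    disjoint : ∀ {ys} → ¬ (ys ∈ map (x ∷_) (sublists N xs) × ys ∈ sublists N xs)
    disjoint (ys∈₁ , ys∈₂) with ∈-map⁻ (x ∷_) ys∈₁
    ... | zs , _ , refl = All.lookup x∉xs (∈-sublists⁻ ys∈₂ (here refl)) refl

  sublist≡filter : ∀ {p} {P : Pred A p} (P? : Decidable P) {xs ys : List A} → Unique xs → ys ∈ sublists N xs →
                   (∀ {z} → z ∈ xs → P z ⇔ z ∈ ys) → ys ≡ filter P? xs
  sublist≡filter P? {[]} _ (here refl) _ = refl
  sublist≡filter {P = P} P? {x ∷ xs} (x∉xs ∷ xs!) ys∈ P⇔∈ with ∈-++⁻ (map (x ∷_) (sublists N xs)) ys∈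
  ... | inj₂ ys∈′ = trans (sublist≡filter P? xs! ys∈′ (P⇔∈ ∘ there)) (sym (filter-reject P? ¬Px))
    where
    ¬Px : ¬ P x
    ¬Px Px = All.lookup x∉xs (∈-sublists⁻ ys∈′ (to (P⇔∈ (here refl)) Px)) refl
  ... | inj₁ ys∈′ with ∈-map⁻ (x ∷_) ys∈′
  ...   | zs , zs∈ , refl =
    trans (cong (x ∷_) (sublist≡filter P? xs! zs∈ P⇔∈zs)) (sym (filter-accept P? (from (P⇔∈ (here refl)) (here refl))))
    where
    P⇔∈zs : ∀ {z} → z ∈ xs → P z ⇔ z ∈ zs
    P⇔∈zs {z} z∈xs = mk⇔ (λ Pz → drop-x (to (P⇔∈ (there z∈xs)) Pz)) (λ z∈zs → from (P⇔∈ (there z∈xs)) (there z∈zs))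
      where
      drop-x : z ∈ x ∷ zs → z ∈ zs
      drop-x (here refl) = contradiction refl (All.lookup x∉xs z∈xs)
      drop-x (there z∈zs) = z∈zs

module _ {N : ℕ} where

  memT⇔Any : ∀ ts {x : Tup N ts} {xs} → T (memT N ts x xs) ⇔ Any (T ∘ eqT N ts x) xs
  memT⇔Any ts {xs = []} = mk⇔ (λ ()) (λ ())
  memT⇔Any ts {xs = y ∷ xs} = mk⇔
    (λ t → [ here , there ∘ to (memT⇔Any ts) ]′ (to T-∨ t))
    (λ { (here e) → from T-∨ (inj₁ e) ; (there a) → from T-∨ (inj₂ (from (memT⇔Any ts) a)) })

  subT⇔All : ∀ ts {xs ys : List (Tup N ts)} → T (subT N ts xs ys) ⇔ All (λ x → T (memT N ts x ys)) xs
  subT⇔All ts {[]} = mk⇔ (λ _ → []) (λ _ → tt)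
  subT⇔All ts {x ∷ xs} = mk⇔
    (λ t → let m , s = to T-∧ t in m ∷ to (subT⇔All ts) s)
    (λ { (m ∷ s) → from T-∧ (m , from (subT⇔All ts) s) })

  eqT-appT : ∀ ts us {x x′ : Tup N ts} {u u′ : Tup N us} → T (eqT N ts x x′) → T (eqT N us u u′) →
             T (eqT N (ts ++ us) (appT N ts us x u) (appT N ts us x′ u′))
  eqT-appT [] us _ u≈u′ = u≈u′
  eqT-appT (t ∷ ts) us x≈x′ u≈u′ =
    let a≈a′ , xs≈xs′ = to T-∧ x≈x′ in from T-∧ (a≈a′ , eqT-appT ts us xs≈xs′ u≈u′)

  eqV-tup⁺ : ∀ ts {xs ys : List (Tup N ts)} →
             (∀ {x} → x ∈ xs → Any (T ∘ eqT N ts x) ys) → (∀ {y} → y ∈ ys → Any (T ∘ eqT N ts y) xs) →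
             T (eqV N (tup ts) xs ys)
  eqV-tup⁺ ts xs≲ys ys≲xs = from T-∧ (from (subT⇔All ts) (All.tabulate (λ x∈ → from (memT⇔Any ts) (xs≲ys x∈))) ,
                                      from (subT⇔All ts) (All.tabulate (λ y∈ → from (memT⇔Any ts) (ys≲xs y∈))))

  eqT⇔≡ : ∀ {ts} → Flat ts → {x y : Tup N ts} → T (eqT N ts x y) ⇔ x ≡ y
  eqT⇔≡ [] = mk⇔ (λ _ → refl) (λ _ → tt)
  eqT⇔≡ (refl ∷ fl) = mk⇔
    (λ t → let a≡b , xs≈ys = to T-∧ t in cong₂ _,_ (toWitness a≡b) (to (eqT⇔≡ fl) xs≈ys))
    (λ { refl → from T-∧ (fromWitness refl , from (eqT⇔≡ fl) refl) })

  memT⇔∈ : ∀ {ts} → Flat ts → {x : Tup N ts} {xs : List (Tup N ts)} → T (memT N ts x xs) ⇔ x ∈ xs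
  memT⇔∈ {ts} fl = mk⇔ (Any.map (to (eqT⇔≡ fl)) ∘ to (memT⇔Any ts)) (from (memT⇔Any ts) ∘ Any.map (from (eqT⇔≡ fl)))

  subT⇔⊆ : ∀ {ts} → Flat ts → {xs ys : List (Tup N ts)} → T (subT N ts xs ys) ⇔ xs ⊆ ys
  subT⇔⊆ {ts} fl {xs} {ys} = mk⇔ sub⇒⊆ ⊆⇒sub
    where
    sub⇒⊆ : T (subT N ts xs ys) → xs ⊆ ys
    sub⇒⊆ t x∈xs = to (memT⇔∈ fl) (All.lookup (to (subT⇔All ts) t) x∈xs)
    ⊆⇒sub : xs ⊆ ys → T (subT N ts xs ys)
    ⊆⇒sub xs⊆ys = from (subT⇔All ts) (All.tabulate (λ x∈xs → from (memT⇔∈ fl) (xs⊆ys x∈xs)))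

  eqV⇔∼set : ∀ {ts} → Flat ts → {xs ys : List (Tup N ts)} → T (eqV N (tup ts) xs ys) ⇔ xs ∼[ set ] ys
  eqV⇔∼set fl = mk⇔
    (λ t → let xs⊆ys , ys⊆xs = to T-∧ t in λ {z} → mk⇔ (to (subT⇔⊆ fl) xs⊆ys) (to (subT⇔⊆ fl) ys⊆xs))
    (λ xs∼ys → from T-∧ (from (subT⇔⊆ fl) (λ {x} x∈ → to (xs∼ys {x}) x∈) ,
                         from (subT⇔⊆ fl) (λ {x} x∈ → from (xs∼ys {x}) x∈)))

  allT-∷ : ∀ t ts → allT N (t ∷ ts) ≡ cartesianProduct (allV N t) (allT N ts)
  allT-∷ t ts = concatMap-map≡cartesianProductWith _,_ (allV N t) (allT N ts)

  ∈-allT-∷⁺ : ∀ {t ts a x} → a ∈ allV N t → x ∈ allT N ts → (a , x) ∈ allT N (t ∷ ts)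
  ∈-allT-∷⁺ {t} {ts} a∈ x∈ = subst ((_ , _) ∈_) (sym (allT-∷ t ts)) (∈-cartesianProduct⁺ a∈ x∈)

  ∈-allT-∷⁻ : ∀ {t ts a x} → (a , x) ∈ allT N (t ∷ ts) → a ∈ allV N t × x ∈ allT N ts
  ∈-allT-∷⁻ {t} {ts} ax∈ = ∈-cartesianProduct⁻ (allV N t) (allT N ts) (subst ((_ , _) ∈_) (allT-∷ t ts) ax∈)

  ∈-allT : ∀ {ts} → Flat ts → (x : Tup N ts) → x ∈ allT N ts
  ∈-allT [] tt = here refl
  ∈-allT (refl ∷ fl) (a , x) = ∈-allT-∷⁺ (∈-allFin a) (∈-allT fl x)

  mutual
    allV-Unique : ∀ τ → Unique (allV N τ)
    allV-Unique base = Unique.allFin⁺ N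
    allV-Unique (tup ts) = sublists⁺ {N = N} (allT-Unique ts)

    allT-Unique : ∀ ts → Unique (allT N ts)
    allT-Unique [] = [] ∷ []
    allT-Unique (t ∷ ts) = subst Unique (sym (allT-∷ t ts)) (Unique.cartesianProduct⁺ (allV-Unique t) (allT-Unique ts))

module _ {N : ℕ} where

  lookup∈ : ∀ {ts t} → t ∈ ts → Tup N ts → Val N t
  lookup∈ (here refl) (a , _) = a
  lookup∈ (there t∈) (_ , x) = lookup∈ t∈ x

  lookupT-index : ∀ {ts t} (t∈ : t ∈ ts) (x : Tup N ts) →
                  subst (Val N) (sym (lookup-index t∈)) (lookupT N ts x (Any.index t∈)) ≡ lookup∈ t∈ x
  lookupT-index (here refl) (a , _) = refl
  lookupT-index (there t∈) (_ , x) = lookupT-index t∈ x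

  lookup∈-++⁺ˡ : ∀ {ts us t} (t∈ : t ∈ ts) (x : Tup N ts) (u : Tup N us) →
                 lookup∈ (∈-++⁺ˡ t∈) (appT N ts us x u) ≡ lookup∈ t∈ x
  lookup∈-++⁺ˡ (here refl) _ _ = refl
  lookup∈-++⁺ˡ (there t∈) (_ , x) u = lookup∈-++⁺ˡ t∈ x u

  lookup∈-++⁺ʳ : ∀ ts {us t} (t∈ : t ∈ us) (x : Tup N ts) (u : Tup N us) →
                 lookup∈ (∈-++⁺ʳ ts t∈) (appT N ts us x u) ≡ lookup∈ t∈ u
  lookup∈-++⁺ʳ [] t∈ _ _ = refl
  lookup∈-++⁺ʳ (_ ∷ ts) t∈ (_ , x) u = lookup∈-++⁺ʳ ts t∈ x u

  projT∈ : ∀ {ts us} → All (_∈ ts) us → Tup N ts → Tup N us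
  projT∈ [] _ = tt
  projT∈ (t∈ ∷ ps) x = lookup∈ t∈ x , projT∈ ps x

  projT∈-tabulate : ∀ {ts us} (f : ∀ {t} → t ∈ us → t ∈ ts) (x : Tup N ts) (u : Tup N us) →
                    (∀ {t} (t∈ : t ∈ us) → lookup∈ (f t∈) x ≡ lookup∈ t∈ u) → projT∈ (All.tabulate f) x ≡ u
  projT∈-tabulate {us = []} f x tt _ = refl
  projT∈-tabulate {us = _ ∷ _} f x (a , u) f-lookup =
    cong₂ _,_ (f-lookup (here refl)) (projT∈-tabulate (f ∘ there) x u (f-lookup ∘ there))

  projT∈-++⁺ : ∀ {ts us vs} (ps : All (_∈ ts) us) (qs : All (_∈ ts) vs) (x : Tup N ts) →
               projT∈ (All++⁺ ps qs) x ≡ appT N us vs (projT∈ ps x) (projT∈ qs x)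
  projT∈-++⁺ [] qs x = refl
  projT∈-++⁺ (t∈ ∷ ps) qs x = cong (lookup∈ t∈ x ,_) (projT∈-++⁺ ps qs x)

indices : ∀ {ts us : List Ty} → All (_∈ ts) us → List (Fin (length ts))
indices [] = []
indices (t∈ ∷ ps) = Any.index t∈ ∷ indices ps

lookup-indices : ∀ {ts us : List Ty} (ps : All (_∈ ts) us) → map (lookup ts) (indices ps) ≡ us
lookup-indices [] = refl
lookup-indices (t∈ ∷ ps) = cong₂ _∷_ (sym (lookup-index t∈)) (lookup-indices ps)

proj∈ : ∀ {Γ ts us} → All (_∈ ts) us → Expr Γ ts → Expr Γ us
proj∈ ps e = subst (Expr _) (lookup-indices ps) (proj (indices ps) e)

sel∈ : ∀ {Γ ts t} → t ∈ ts → t ∈ ts → Expr Γ ts → Expr Γ ts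
sel∈ a b = sel (Any.index a) (Any.index b) (trans (sym (lookup-index a)) (lookup-index b))

proj∈-preserves : ∀ {Γ ts us} (P : ∀ {vs} → Expr Γ vs → Set) (ps : All (_∈ ts) us) {e : Expr Γ ts} →
                  P (proj (indices ps) e) → P (proj∈ ps e)
proj∈-preserves P ps = preserves (lookup-indices ps)
  where
  preserves : ∀ {vs ws} (eq : vs ≡ ws) {e : Expr _ vs} → P e → P (subst (Expr _) eq e)
  preserves refl Pe = Pe

module _ {N : ℕ} where

  ⟦subst⟧ : ∀ {Γ ts us} (eq : ts ≡ us) (e : Expr Γ ts) (ρ : Env N Γ) →
            ⟦_⟧ N (subst (Expr Γ) eq e) ρ ≡ map (subst (Tup N) eq) (⟦_⟧ N e ρ)
  ⟦subst⟧ refl e ρ = sym (map-id (⟦_⟧ N e ρ))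

  subst-∷ : ∀ {t t′ ts ts′} (p : t ≡ t′) (q : ts ≡ ts′) (a : Val N t) (x : Tup N ts) →
            subst (Tup N) (cong₂ _∷_ p q) (a , x) ≡ (subst (Val N) p a , subst (Tup N) q x)
  subst-∷ refl refl a x = refl

  projT-indices : ∀ {ts us} (ps : All (_∈ ts) us) (x : Tup N ts) →
                  subst (Tup N) (lookup-indices ps) (projT N ts (indices ps) x) ≡ projT∈ ps x
  projT-indices [] x = refl
  projT-indices (t∈ ∷ ps) x =
    trans (subst-∷ (sym (lookup-index t∈)) (lookup-indices ps) _ _)
          (cong₂ _,_ (lookupT-index t∈ x) (projT-indices ps x))

  ⟦proj∈⟧ : ∀ {Γ ts us} (ps : All (_∈ ts) us) (e : Expr Γ ts) (ρ : Env N Γ) →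
            ⟦_⟧ N (proj∈ ps e) ρ ≡ map (projT∈ ps) (⟦_⟧ N e ρ)
  ⟦proj∈⟧ ps e ρ = begin
    ⟦_⟧ N (proj∈ ps e) ρ
      ≡⟨ ⟦subst⟧ (lookup-indices ps) (proj (indices ps) e) ρ ⟩
    map (subst (Tup N) (lookup-indices ps)) (map (projT N _ (indices ps)) (⟦_⟧ N e ρ))
      ≡⟨ sym (map-∘ (⟦_⟧ N e ρ)) ⟩
    map (subst (Tup N) (lookup-indices ps) ∘ projT N _ (indices ps)) (⟦_⟧ N e ρ)
      ≡⟨ map-cong (projT-indices ps) (⟦_⟧ N e ρ) ⟩
    map (projT∈ ps) (⟦_⟧ N e ρ)
      ∎
    where open ≡-Reasoning

  eqV-subst : ∀ {t τ₁ τ₂} (q₁ : t ≡ τ₁) (q₂ : t ≡ τ₂) (u : Val N τ₁) (v : Val N τ₂) →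
              eqV N τ₂ (subst (Val N) (trans (sym q₁) q₂) u) v ≡
              eqV N t (subst (Val N) (sym q₁) u) (subst (Val N) (sym q₂) v)
  eqV-subst refl refl u v = refl

  ∈-⟦sel∈⟧ : ∀ {Γ ts t} (a b : t ∈ ts) (e : Expr Γ ts) (ρ : Env N Γ) {x} →
             x ∈ ⟦_⟧ N (sel∈ a b e) ρ ⇔ (x ∈ ⟦_⟧ N e ρ × T (eqV N t (lookup∈ a x) (lookup∈ b x)))
  ∈-⟦sel∈⟧ {ts = ts} {t} a b e ρ {x} = mk⇔
    (λ x∈ → let x∈e , sel-x = ∈-filter⁻ (T? ∘ test) x∈ in x∈e , subst T test≡ sel-x)
    (λ { (x∈e , eq-x) → ∈-filter⁺ (T? ∘ test) x∈e (subst T (sym test≡) eq-x) })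
    where
    test : Tup N ts → Bool
    test y = eqV N (lookup ts (Any.index b)) (subst (Val N) (trans (sym (lookup-index a)) (lookup-index b))
               (lookupT N ts y (Any.index a))) (lookupT N ts y (Any.index b))
    test≡ : test x ≡ eqV N t (lookup∈ a x) (lookup∈ b x)
    test≡ = trans (eqV-subst (lookup-index a) (lookup-index b) _ _) (cong₂ (eqV N t) (lookupT-index a x) (lookupT-index b x))

infix 6 _⊈_

_⊈_ : ∀ {Γ ts} → Expr Γ ts → Expr Γ ts → Expr Γ []
e ⊈ f = proj [] (e ∖ f)

module _ {N : ℕ} {Γ : Ctx} where

  ⟦⊈⟧≡[]⇔ : ∀ {ts} → Flat ts → (e f : Expr Γ ts) (ρ : Env N Γ) → ⟦_⟧ N (e ⊈ f) ρ ≡ [] ⇔ ⟦_⟧ N e ρ ⊆ ⟦_⟧ N f ρ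
  ⟦⊈⟧≡[]⇔ {ts} fl e f ρ =
    ⇔.trans (mk⇔ map≡[]⇒≡[] (cong (map (projT N ts []))))
    (⇔.trans (filterᵇ-not≡[]⇔ (λ x → memT N ts x (⟦_⟧ N f ρ)) (⟦_⟧ N e ρ))
    (⇔.trans (⇔.sym (subT⇔All ts)) (subT⇔⊆ fl)))
    where
    map≡[]⇒≡[] : ∀ {xs : List (Tup N ts)} → map (projT N ts []) xs ≡ [] → xs ≡ []
    map≡[]⇒≡[] {[]} _ = refl

  ⟦∪⟧≡[]⇔ : ∀ {ts} {P Q : Set} (e f : Expr Γ ts) (ρ : Env N Γ) →
            ⟦_⟧ N e ρ ≡ [] ⇔ P → ⟦_⟧ N f ρ ≡ [] ⇔ Q → ⟦_⟧ N (e ∪ f) ρ ≡ [] ⇔ (P × Q)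
  ⟦∪⟧≡[]⇔ e f ρ e⇔P f⇔Q = ⇔.trans
    (mk⇔ (λ eq → ++-conicalˡ _ _ eq , ++-conicalʳ _ _ eq) (λ { (eq₁ , eq₂) → cong₂ _++_ eq₁ eq₂ }))
    (e⇔P ×-⇔ f⇔Q)

  ∈-⟦⊗⟧ : ∀ {ts us} (e : Expr Γ ts) (f : Expr Γ us) (ρ : Env N Γ) {w} →
          w ∈ ⟦_⟧ N (e ⊗ f) ρ ⇔ (∃₂ λ x u → x ∈ ⟦_⟧ N e ρ × u ∈ ⟦_⟧ N f ρ × w ≡ appT N ts us x u)
  ∈-⟦⊗⟧ {ts} {us} e f ρ = mk⇔
    (λ w∈ → ∈-cartesianProductWith⁻ (appT N ts us) (⟦_⟧ N e ρ) (⟦_⟧ N f ρ) (subst (_ ∈_) ⟦e⊗f⟧≡ w∈))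
    (λ { (x , u , x∈ , u∈ , refl) → subst (_ ∈_) (sym ⟦e⊗f⟧≡) (∈-cartesianProductWith⁺ (appT N ts us) x∈ u∈) })
    where
    ⟦e⊗f⟧≡ : ⟦_⟧ N (e ⊗ f) ρ ≡ cartesianProductWith (appT N ts us) (⟦_⟧ N e ρ) (⟦_⟧ N f ρ)
    ⟦e⊗f⟧≡ = concatMap-map≡cartesianProductWith (appT N ts us) (⟦_⟧ N e ρ) (⟦_⟧ N f ρ)

  ∈-⟦unnest⟧ : ∀ {ts us} (i : Fin (length ts)) (p : lookup ts i ≡ tup us) (e : Expr Γ ts) (ρ : Env N Γ) {z} →
               z ∈ ⟦_⟧ N (unnest i p e) ρ ⇔
               (∃₂ λ x u → x ∈ ⟦_⟧ N e ρ × u ∈ subst (Val N) p (lookupT N ts x i) × z ≡ appT N ts us x u)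
  ∈-⟦unnest⟧ {ts} {us} i p e ρ = mk⇔
    (λ z∈ → let x , x∈ , z∈x = find (∈-concatMap⁻ unnestAt z∈) ; u , u∈ , z≡ = ∈-map⁻ (appT N ts us x) z∈x
            in x , u , x∈ , u∈ , z≡)
    (λ { (x , u , x∈ , u∈ , refl) → ∈-concatMap⁺ unnestAt (lose x∈ (∈-map⁺ (appT N ts us x) u∈)) })
    where
    unnestAt : Tup N ts → List (Tup N (ts ++ us))
    unnestAt x = map (appT N ts us x) (subst (Val N) p (lookupT N ts x i))

  eqV-∖-self⇔≡[] : (xs : List (Tup N [])) → T (eqV N (tup []) xs (filterᵇ (λ x → not (memT N [] x xs)) xs)) ⇔ xs ≡ []
  eqV-∖-self⇔≡[] xs = mk⇔
    (λ t → ⊆[]⇒≡[] (to (subT⇔⊆ []) (proj₁ (to T-∧ (subst (T ∘ eqV N (tup []) xs) xs∖xs≡[] t)))))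
    (λ xs≡[] → subst (λ ys → T (eqV N (tup []) ys (filterᵇ (λ x → not (memT N [] x ys)) ys))) (sym xs≡[]) tt)
    where
    xs∖xs≡[] : filterᵇ (λ x → not (memT N [] x xs)) xs ≡ []
    xs∖xs≡[] = from (filterᵇ-not≡[]⇔ _ xs) (All.tabulate (from (memT⇔∈ [])))
    ⊆[]⇒≡[] : ∀ {ys : List (Tup N [])} → ys ⊆ [] → ys ≡ []
    ⊆[]⇒≡[] {[]} _ = refl
    ⊆[]⇒≡[] {_ ∷ _} ys⊆[] with () ← ys⊆[] (here refl)

  ⟦sol⟧-Unique : ∀ {σ} Xs (e f : Expr (Γ ++ Xs) σ) (ρ : Env N Γ) → Unique (⟦_⟧ N (sol Xs e f) ρ)
  ⟦sol⟧-Unique Xs e f ρ = Unique.filter⁺ _ (allT-Unique (map tup Xs))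

  ∈-⟦sol⟧ : ∀ Xs (u : Expr (Γ ++ Xs) []) (ρ : Env N Γ) {A} →
            A ∈ ⟦_⟧ N (sol Xs u (u ∖ u)) ρ ⇔ (A ∈ allT N (map tup Xs) × ⟦_⟧ N u (appEnv N Γ Xs ρ A) ≡ [])
  ∈-⟦sol⟧ Xs u ρ = mk⇔
    (λ A∈ → let A∈all , t = ∈-filter⁻ (T? ∘ solves) A∈ in A∈all , to (eqV-∖-self⇔≡[] _) t)
    (λ { (A∈all , u≡[]) → ∈-filter⁺ (T? ∘ solves) A∈all (from (eqV-∖-self⇔≡[] _) u≡[]) })
    where
    solves : Tup N (map tup Xs) → Bool
    solves A = eqV N (tup []) (⟦_⟧ N u (appEnv N Γ Xs ρ A)) (⟦_⟧ N (u ∖ u) (appEnv N Γ Xs ρ A))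

col : ∀ {ts} → Flat ts → Fin (length ts) → base ∈ ts
col (_ ∷ fl) (suc j) = there (col fl j)
col (refl ∷ _) zero = here refl

map-lookup-Flat : ∀ {ts} → Flat ts → (is : List (Fin (length ts))) → Flat (map (lookup ts) is)
map-lookup-Flat fl is = All-map⁺ (All.universal (λ i → All.lookup fl (∈-lookup i)) is)

module _ {N : ℕ} where

  Flat-ext : ∀ {ts} (fl : Flat ts) {x y : Tup N ts} →
             (∀ j → lookup∈ (col fl j) x ≡ lookup∈ (col fl j) y) → x ≡ y
  Flat-ext [] {tt} {tt} _ = refl
  Flat-ext (refl ∷ fl) {_ , _} {_ , _} x≗y = cong₂ _,_ (x≗y zero) (Flat-ext fl (x≗y ∘ suc))

  eqV-lookupT : ∀ {ts} (fl : Flat ts) (x y : Tup N ts) j →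
                eqV N (lookup ts j) (lookupT N ts x j) (lookupT N ts y j) ≡ ⌊ lookup∈ (col fl j) x F.≟ lookup∈ (col fl j) y ⌋
  eqV-lookupT (refl ∷ _) (_ , _) (_ , _) zero = refl
  eqV-lookupT (_ ∷ fl) (_ , x) (_ , y) (suc j) = eqV-lookupT fl x y j

  canon : ∀ {ts} → List (Tup N ts) → List (Tup N ts)
  canon {ts} xs = filterᵇ (λ x → memT N ts x xs) (allT N ts)

  canon∈sublists : ∀ {ts} (xs : List (Tup N ts)) → canon xs ∈ sublists N (allT N ts)
  canon∈sublists {ts} xs = filter∈sublists {N = N} (T? ∘ λ x → memT N ts x xs) (allT N ts)

  canon-∼ : ∀ {ts} → Flat ts → (xs : List (Tup N ts)) → canon xs ∼[ set ] xs
  canon-∼ {ts} fl xs {x} = mk⇔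
    (λ x∈ → to (memT⇔∈ fl) (proj₂ (∈-filter⁻ (T? ∘ λ y → memT N ts y xs) {xs = allT N ts} x∈)))
    (λ x∈ → ∈-filter⁺ (T? ∘ λ y → memT N ts y xs) (∈-allT fl x) (from (memT⇔∈ fl) x∈))

  sublist≡canon : ∀ {ts} → Flat ts → {xs ys : List (Tup N ts)} →
                  xs ∈ sublists N (allT N ts) → xs ∼[ set ] ys → xs ≡ canon ys
  sublist≡canon {ts} fl {xs} {ys} xs∈ xs∼ys =
    sublist≡filter {N = N} (T? ∘ λ x → memT N ts x ys) (allT-Unique ts) xs∈ (λ _ → ⇔.trans (memT⇔∈ fl) (⇔.sym xs∼ys))

  length≤sizeL : ∀ ts (xs : List (Tup N ts)) → length xs ≤ sizeL N ts xs
  length≤sizeL ts [] = z≤n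
  length≤sizeL ts (x ∷ xs) = s≤s (≤-trans (length≤sizeL ts xs) (m≤n+m (sizeL N ts xs) (sizeT N ts x)))

module Nesting {ts : List Ty} (fl : Flat ts) (is : List (Fin (length ts))) where

  σ : List Ty
  σ = map (lookup ts) is

  flσ : Flat σ
  flσ = map-lookup-Flat fl is

  isNested : Fin (length ts) → Bool
  isNested j = any (λ i → ⌊ i F.≟ j ⌋) is

  key : List (Fin (length ts))
  key = filterᵇ (not ∘ isNested) (allFin (length ts))

  agreeOn : ∀ {Γ} → List (Fin (length ts)) → Expr Γ (ts ++ ts) → Expr Γ (ts ++ ts)
  agreeOn [] e = e
  agreeOn (j ∷ js) e = sel∈ (∈-++⁺ˡ (col fl j)) (∈-++⁺ʳ ts (col fl j)) (agreeOn js e)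

  Γ₃ : Ctx
  Γ₃ = ts ∷ ts ∷ σ ∷ []

  relR relY : Expr Γ₃ ts
  relR = var (here refl)
  relY = var (there (here refl))

  relS : Expr Γ₃ σ
  relS = var (there (there (here refl)))

  rightHalf : All (_∈ ts ++ ts) ts
  rightHalf = All.tabulate (∈-++⁺ʳ ts)

  matching : Expr Γ₃ ts
  matching = proj∈ rightHalf (agreeOn key (relY ⊗ relR))

  group : Expr Γ₃ σ
  group = proj is matching

  diagonal : Expr Γ₃ (ts ++ ts)
  diagonal = agreeOn (allFin (length ts)) (relY ⊗ relY)

  emptyY Y⊈R Y²⊈diagonal S⊈group group⊈S : Expr Γ₃ []
  emptyY = proj [] dom ⊈ proj [] relY
  Y⊈R = relY ⊈ relR
  Y²⊈diagonal = relY ⊗ relY ⊈ diagonal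
  S⊈group = relS ⊈ group
  group⊈S = group ⊈ relS

  violations : Expr Γ₃ []
  violations = emptyY ∪ (Y⊈R ∪ (Y²⊈diagonal ∪ (S⊈group ∪ group⊈S)))

  -- violations ∖ violations is always empty, so this is the equation violations = ∅.
  solutions : Expr (ts ∷ []) (tup ts ∷ tup σ ∷ [])
  solutions = sol (ts ∷ σ ∷ []) violations (violations ∖ violations)

  outputColumns : All (_∈ tup ts ∷ tup σ ∷ ts) (ts ++ tup σ ∷ [])
  outputColumns = All++⁺ (All.tabulate (λ t∈ → there (there t∈))) (there (here refl) ∷ [])

  nesting : Expr (ts ∷ []) (ts ++ tup σ ∷ [])
  nesting = proj∈ outputColumns (unnest zero refl solutions)

  agreeOn-NoNest : ∀ {Γ} js (e : Expr Γ (ts ++ ts)) → NoNest e → NoNest (agreeOn js e)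
  agreeOn-NoNest [] e ok = ok
  agreeOn-NoNest (_ ∷ js) e ok = agreeOn-NoNest js e ok

  agreeOn-AllSparse : ∀ {Γ} js (e : Expr Γ (ts ++ ts)) → AllSparse e → AllSparse (agreeOn js e)
  agreeOn-AllSparse [] e ok = ok
  agreeOn-AllSparse (_ ∷ js) e ok = agreeOn-AllSparse js e ok

  matching-NoNest : NoNest matching
  matching-NoNest = proj∈-preserves NoNest rightHalf (agreeOn-NoNest key (relY ⊗ relR) (tt , tt))

  matching-AllSparse : AllSparse matching
  matching-AllSparse = proj∈-preserves AllSparse rightHalf (agreeOn-AllSparse key (relY ⊗ relR) (tt , tt))

  violations-NoNest : NoNest violations
  violations-NoNest =
    (tt , tt) , (tt , tt) , ((tt , tt) , agreeOn-NoNest (allFin (length ts)) (relY ⊗ relY) (tt , tt)) ,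
    (tt , matching-NoNest) , (matching-NoNest , tt)

  violations-AllSparse : AllSparse violations
  violations-AllSparse =
    (tt , tt) , (tt , tt) , ((tt , tt) , agreeOn-AllSparse (allFin (length ts)) (relY ⊗ relY) (tt , tt)) ,
    (tt , matching-AllSparse) , (matching-AllSparse , tt)

  nesting-NoNest : NoNest nesting
  nesting-NoNest = proj∈-preserves NoNest outputColumns (violations-NoNest , violations-NoNest , violations-NoNest)

  module Semantics (n : ℕ) where

    N : ℕ
    N = suc n

    _!_ : Tup N ts → Fin (length ts) → Fin N
    x ! j = lookup∈ (col fl j) x

    Agree : List (Fin (length ts)) → Tup N ts → Tup N ts → Set
    Agree js x y = ∀ {j} → j ∈ js → x ! j ≡ y ! j

    agreeAt : ∀ j {x y : Tup N ts} →
              T (eqV N base (lookup∈ (∈-++⁺ˡ (col fl j)) (appT N ts ts x y))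
                            (lookup∈ (∈-++⁺ʳ ts (col fl j)) (appT N ts ts x y))) ⇔ x ! j ≡ y ! j
    agreeAt j {x} {y} rewrite lookup∈-++⁺ˡ (col fl j) x y | lookup∈-++⁺ʳ ts (col fl j) x y = mk⇔ toWitness fromWitness

    ⟦agreeOn⟧⊆ : ∀ {Γ} js (e : Expr Γ (ts ++ ts)) (ρ : Env N Γ) → ⟦_⟧ N (agreeOn js e) ρ ⊆ ⟦_⟧ N e ρ
    ⟦agreeOn⟧⊆ [] e ρ w∈ = w∈
    ⟦agreeOn⟧⊆ (j ∷ js) e ρ w∈ = ⟦agreeOn⟧⊆ js e ρ (proj₁ (to (∈-⟦sel∈⟧ _ _ (agreeOn js e) ρ) w∈))

    ∈-⟦agreeOn⟧ : ∀ {Γ} js (e : Expr Γ (ts ++ ts)) (ρ : Env N Γ) {x y} →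
                  appT N ts ts x y ∈ ⟦_⟧ N (agreeOn js e) ρ ⇔ (appT N ts ts x y ∈ ⟦_⟧ N e ρ × Agree js x y)
    ∈-⟦agreeOn⟧ [] e ρ = mk⇔ (λ w∈ → w∈ , λ ()) proj₁
    ∈-⟦agreeOn⟧ (j ∷ js) e ρ {x} {y} =
      ⇔.trans (∈-⟦sel∈⟧ _ _ (agreeOn js e) ρ) (⇔.trans (∈-⟦agreeOn⟧ js e ρ ×-⇔ agreeAt j) (mk⇔ extend restrict))
      where
      extend : ∀ {P : Set} → (P × Agree js x y) × x ! j ≡ y ! j → P × Agree (j ∷ js) x y
      extend ((p , x≈y) , x≈ⱼy) = p , λ { (here refl) → x≈ⱼy ; (there j∈) → x≈y j∈ }
      restrict : ∀ {P : Set} → P × Agree (j ∷ js) x y → (P × Agree js x y) × x ! j ≡ y ! j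
      restrict (p , x≈y) = (p , λ j∈ → x≈y (there j∈)) , x≈y (here refl)

    projT∈-rightHalf : (x y : Tup N ts) → projT∈ rightHalf (appT N ts ts x y) ≡ y
    projT∈-rightHalf x y = projT∈-tabulate (∈-++⁺ʳ ts) (appT N ts ts x y) y (λ t∈ → lookup∈-++⁺ʳ ts t∈ x y)

    ∈-⟦matching⟧ : ∀ {R Y : List (Tup N ts)} {S r} →
                   r ∈ ⟦_⟧ N matching (R , Y , S , tt) ⇔ (r ∈ R × ∃ λ y → y ∈ Y × Agree key y r)
    ∈-⟦matching⟧ {R} {Y} {S} {r} = mk⇔ matched match
      where
      ρ : Env N Γ₃
      ρ = R , Y , S , tt
      ⟦matching⟧≡ : ⟦_⟧ N matching ρ ≡ map (projT∈ rightHalf) (⟦_⟧ N (agreeOn key (relY ⊗ relR)) ρ)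
      ⟦matching⟧≡ = ⟦proj∈⟧ rightHalf (agreeOn key (relY ⊗ relR)) ρ
      matched : r ∈ ⟦_⟧ N matching ρ → r ∈ R × ∃ λ y → y ∈ Y × Agree key y r
      matched r∈ with ∈-map⁻ (projT∈ rightHalf) (subst (r ∈_) ⟦matching⟧≡ r∈)
      ... | w , w∈ , refl with to (∈-⟦⊗⟧ relY relR ρ) (⟦agreeOn⟧⊆ key (relY ⊗ relR) ρ w∈)
      ... | y , r′ , y∈ , r′∈ , refl rewrite projT∈-rightHalf y r′ =
        r′∈ , y , y∈ , proj₂ (to (∈-⟦agreeOn⟧ key (relY ⊗ relR) ρ) w∈)
      match : r ∈ R × ∃ (λ y → y ∈ Y × Agree key y r) → r ∈ ⟦_⟧ N matching ρ
      match (r∈ , y , y∈ , y≈r) =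
        subst (r ∈_) (sym ⟦matching⟧≡) (subst (_∈ _) (projT∈-rightHalf y r) (∈-map⁺ (projT∈ rightHalf)
          (from (∈-⟦agreeOn⟧ key (relY ⊗ relR) ρ) (from (∈-⟦⊗⟧ relY relR ρ) (y , r , y∈ , r∈ , refl) , y≈r))))

    agree⇔Agree : ∀ {x y} → T (agree N ts is x y) ⇔ Agree key x y
    agree⇔Agree {x} {y} = mk⇔
      (λ t {j} j∈key → toWitness (subst T (eqV-lookupT fl x y j)
        (resolve (All.lookup (all⁺ test (allFin (length ts)) t) (∈-allFin j))
                   (proj₂ (∈-filter⁻ (T? ∘ (not ∘ isNested)) {xs = allFin (length ts)} j∈key)))))
      (λ x≈y → all⁻ test (All.universal (holds x≈y) (allFin (length ts))))
      where
      test : Fin (length ts) → Bool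
      test j = isNested j ∨ eqV N (lookup ts j) (lookupT N ts x j) (lookupT N ts y j)
      resolve : ∀ {b c} → T (b ∨ c) → T (not b) → T c
      resolve {false} t _ = t
      holds : Agree key x y → ∀ j → T (test j)
      holds x≈y j with isNested j in isNested≡
      ... | true = tt
      ... | false = subst T (sym (eqV-lookupT fl x y j))
        (fromWitness (x≈y (∈-filter⁺ (T? ∘ (not ∘ isNested)) (∈-allFin j) (subst (T ∘ not) (sym isNested≡) tt))))

    groupOf : List (Tup N ts) → Tup N ts → List (Tup N σ)
    groupOf R x = map (projT N ts is) (filterᵇ (agree N ts is x) R)

    ∈-singleton : ∀ {x y : Tup N ts} → y ∈ x ∷ [] → y ≡ x
    ∈-singleton (here y≡x) = y≡x

    ⟦group⟧ : ∀ {R Y S x} → Y ∼[ set ] x ∷ [] → ⟦_⟧ N group (R , Y , S , tt) ∼[ set ] groupOf R x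
    ⟦group⟧ {R} {Y} {S} {x} Y∼[x] = map-∼ (λ _ → refl) (⇔.trans ∈-⟦matching⟧ (mk⇔ agreeing matching-x))
      where
      agreeing : ∀ {r} → r ∈ R × ∃ (λ y → y ∈ Y × Agree key y r) → r ∈ filterᵇ (agree N ts is x) R
      agreeing (r∈ , y , y∈ , y≈r) with ∈-singleton (to Y∼[x] y∈)
      ... | refl = ∈-filter⁺ (T? ∘ agree N ts is x) r∈ (from agree⇔Agree y≈r)
      matching-x : ∀ {r} → r ∈ filterᵇ (agree N ts is x) R → r ∈ R × ∃ (λ y → y ∈ Y × Agree key y r)
      matching-x r∈ = let r∈R , t = ∈-filter⁻ (T? ∘ agree N ts is x) r∈
                      in r∈R , x , from Y∼[x] (here refl) , to agree⇔Agree t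

    Solution : List (Tup N ts) → List (Tup N ts) → List (Tup N σ) → Tup N ts → Set
    Solution R Y S x = x ∈ R × Y ∼[ set ] x ∷ [] × S ∼[ set ] groupOf R x

    Conditions : List (Tup N ts) → List (Tup N ts) → List (Tup N σ) → Set
    Conditions R Y S = (∃ λ y → y ∈ Y) × Y ⊆ R × (∀ {y y′} → y ∈ Y → y′ ∈ Y → y ≡ y′) × S ⊆ G × G ⊆ S
      where
      G : List (Tup N σ)
      G = ⟦_⟧ N group (R , Y , S , tt)

    violations≡[]⇔ : ∀ {R Y S} → ⟦_⟧ N violations (R , Y , S , tt) ≡ [] ⇔ Conditions R Y S
    violations≡[]⇔ {R} {Y} {S} =
      ⟦∪⟧≡[]⇔ emptyY (Y⊈R ∪ (Y²⊈diagonal ∪ (S⊈group ∪ group⊈S))) ρ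
        (⇔.trans (⟦⊈⟧≡[]⇔ [] (proj [] dom) (proj [] relY) ρ) nonempty)
      (⟦∪⟧≡[]⇔ Y⊈R (Y²⊈diagonal ∪ (S⊈group ∪ group⊈S)) ρ (⟦⊈⟧≡[]⇔ fl relY relR ρ)
      (⟦∪⟧≡[]⇔ Y²⊈diagonal (S⊈group ∪ group⊈S) ρ (⇔.trans (⟦⊈⟧≡[]⇔ (All++⁺ fl fl) (relY ⊗ relY) diagonal ρ) allEqual)
      (⟦∪⟧≡[]⇔ S⊈group group⊈S ρ (⟦⊈⟧≡[]⇔ flσ relS group ρ) (⟦⊈⟧≡[]⇔ flσ group relS ρ))))
      where
      ρ : Env N Γ₃
      ρ = R , Y , S , tt
      -- ⟦ proj [] dom ⟧ ρ is {()} because the domain Fin (suc n) is nonempty.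
      nonempty : ⟦_⟧ N (proj [] dom) ρ ⊆ ⟦_⟧ N (proj [] relY) ρ ⇔ (∃ λ y → y ∈ Y)
      nonempty = mk⇔
        (λ dom⊆ → let y , y∈ , _ = ∈-map⁻ (projT N ts []) (dom⊆ (here refl)) in y , y∈)
        (λ { (y , y∈) {tt} _ → ∈-map⁺ (projT N ts []) y∈ })
      allEqual : ⟦_⟧ N (relY ⊗ relY) ρ ⊆ ⟦_⟧ N diagonal ρ ⇔ (∀ {y y′} → y ∈ Y → y′ ∈ Y → y ≡ y′)
      allEqual = mk⇔ offDiagonal onDiagonal
        where
        offDiagonal : ⟦_⟧ N (relY ⊗ relY) ρ ⊆ ⟦_⟧ N diagonal ρ → ∀ {y y′} → y ∈ Y → y′ ∈ Y → y ≡ y′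
        offDiagonal ⊆diagonal y∈ y′∈ = Flat-ext fl (λ j → proj₂ (to (∈-⟦agreeOn⟧ (allFin (length ts)) (relY ⊗ relY) ρ)
          (⊆diagonal (from (∈-⟦⊗⟧ relY relY ρ) (_ , _ , y∈ , y′∈ , refl)))) (∈-allFin j))
        onDiagonal : (∀ {y y′} → y ∈ Y → y′ ∈ Y → y ≡ y′) → ⟦_⟧ N (relY ⊗ relY) ρ ⊆ ⟦_⟧ N diagonal ρ
        onDiagonal Y≡ w∈ with to (∈-⟦⊗⟧ relY relY ρ) w∈
        ... | y , y′ , y∈ , y′∈ , refl =
          from (∈-⟦agreeOn⟧ (allFin (length ts)) (relY ⊗ relY) ρ) (w∈ , λ {j} _ → cong (_! j) (Y≡ y∈ y′∈))

    conditions⇔solution : ∀ {R Y S} → Conditions R Y S ⇔ ∃ (Solution R Y S)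
    conditions⇔solution {R} {Y} {S} = mk⇔ solution conditions
      where
      solution : Conditions R Y S → ∃ (Solution R Y S)
      solution ((y₀ , y₀∈) , Y⊆R , Y≡ , S⊆G , G⊆S) =
        y₀ , Y⊆R y₀∈ , Y∼[y₀] , ⇔.trans (mk⇔ S⊆G G⊆S) (⟦group⟧ Y∼[y₀])
        where
        Y∼[y₀] : Y ∼[ set ] y₀ ∷ []
        Y∼[y₀] = mk⇔ (λ y∈ → here (Y≡ y∈ y₀∈)) (λ { (here refl) → y₀∈ })
      conditions : ∃ (Solution R Y S) → Conditions R Y S
      conditions (x , x∈R , Y∼[x] , S∼) =
        (x , from Y∼[x] (here refl)) , (λ y∈ → subst (_∈ R) (sym (≡x y∈)) x∈R) , (λ y∈ y′∈ → trans (≡x y∈) (sym (≡x y′∈))) ,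
        (λ s∈ → from (⟦group⟧ Y∼[x]) (to S∼ s∈)) , (λ s∈ → from S∼ (to (⟦group⟧ Y∼[x]) s∈))
        where
        ≡x : ∀ {y} → y ∈ Y → y ≡ x
        ≡x y∈ = ∈-singleton (to Y∼[x] y∈)

    ∈-⟦solutions⟧ : ∀ {R Y S} → (Y , S , tt) ∈ ⟦_⟧ N solutions (R , tt) ⇔
                    ((Y , S , tt) ∈ allT N (tup ts ∷ tup σ ∷ []) × ∃ (Solution R Y S))
    ∈-⟦solutions⟧ {R} = ⇔.trans (∈-⟦sol⟧ (ts ∷ σ ∷ []) violations (R , tt))
                                (⇔.refl ×-⇔ ⇔.trans violations≡[]⇔ conditions⇔solution)

    canonicalSolution : List (Tup N ts) → Tup N ts → Tup N (tup ts ∷ tup σ ∷ [])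
    canonicalSolution R x = canon (x ∷ []) , canon (groupOf R x) , tt

    canonicalSolution∈ : ∀ {R x} → x ∈ R → canonicalSolution R x ∈ ⟦_⟧ N solutions (R , tt)
    canonicalSolution∈ {R} {x} x∈R = from (∈-⟦solutions⟧ {R} {canon (x ∷ [])} {canon (groupOf R x)})
      (∈-allT-∷⁺ (canon∈sublists (x ∷ [])) (∈-allT-∷⁺ (canon∈sublists (groupOf R x)) (here refl)) ,
       x , x∈R , canon-∼ fl (x ∷ []) , canon-∼ flσ (groupOf R x))

    solution≡canonical : ∀ {R Y S} → (Y , S , tt) ∈ ⟦_⟧ N solutions (R , tt) →
                         ∃ λ x → x ∈ R × (Y , S , tt) ≡ canonicalSolution R x
    solution≡canonical {R} {Y} {S} A∈ = canonical (to (∈-⟦solutions⟧ {R} {Y} {S}) A∈)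
      where
      canonical : (Y , S , tt) ∈ allT N (tup ts ∷ tup σ ∷ []) × ∃ (Solution R Y S) →
                  ∃ λ x → x ∈ R × (Y , S , tt) ≡ canonicalSolution R x
      canonical (A∈allT , x , x∈R , Y∼ , S∼) =
        x , x∈R , cong₂ _,_ (sublist≡canon fl Y∈ Y∼) (cong (_, tt) (sublist≡canon flσ S∈ S∼))
        where
        Y∈ : Y ∈ sublists N (allT N ts)
        Y∈ = proj₁ (∈-allT-∷⁻ A∈allT)
        S∈ : S ∈ sublists N (allT N σ)
        S∈ = proj₁ (∈-allT-∷⁻ (proj₂ (∈-allT-∷⁻ A∈allT)))

    length-⟦solutions⟧ : ∀ R → length (⟦_⟧ N solutions (R , tt)) ≤ length R
    length-⟦solutions⟧ R = begin
      length (⟦_⟧ N solutions (R , tt))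
        ≤⟨ Unique∧⊆⇒length≤ (⟦sol⟧-Unique (ts ∷ σ ∷ []) violations (violations ∖ violations) (R , tt)) ⊆canonical ⟩
      length (map (canonicalSolution R) R)
        ≡⟨ length-map (canonicalSolution R) R ⟩
      length R
        ∎
      where
      open ≤-Reasoning
      ⊆canonical : ⟦_⟧ N solutions (R , tt) ⊆ map (canonicalSolution R) R
      ⊆canonical {Y , S , tt} A∈ = canonical∈ (solution≡canonical A∈)
        where
        canonical∈ : (∃ λ x → x ∈ R × (Y , S , tt) ≡ canonicalSolution R x) → (Y , S , tt) ∈ map (canonicalSolution R) R
        canonical∈ (x , x∈R , refl) = ∈-map⁺ (canonicalSolution R) x∈R

    projT∈-outputColumns : ∀ Y S (y : Tup N ts) → projT∈ outputColumns (Y , S , y) ≡ appT N ts (tup σ ∷ []) y (S , tt)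
    projT∈-outputColumns Y S y =
      trans (projT∈-++⁺ (All.tabulate (λ t∈ → there (there t∈))) (there (here refl) ∷ []) (Y , S , y))
            (cong (λ y′ → appT N ts (tup σ ∷ []) y′ (S , tt))
                  (projT∈-tabulate (λ t∈ → there (there t∈)) (Y , S , y) y (λ _ → refl)))

    Produces : List (Tup N ts) → Tup N (ts ++ tup σ ∷ []) → Set
    Produces R z = ∃₂ λ Y S → ∃ λ y → (Y , S , tt) ∈ ⟦_⟧ N solutions (R , tt) × y ∈ Y × z ≡ appT N ts (tup σ ∷ []) y (S , tt)

    ∈-⟦nesting⟧ : ∀ {R z} → z ∈ ⟦_⟧ N nesting (R , tt) ⇔ Produces R z
    ∈-⟦nesting⟧ {R} = mk⇔ produced produce
      where
      ⟦nesting⟧≡ : ⟦_⟧ N nesting (R , tt) ≡ map (projT∈ outputColumns) (⟦_⟧ N (unnest zero refl solutions) (R , tt))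
      ⟦nesting⟧≡ = ⟦proj∈⟧ outputColumns (unnest zero refl solutions) (R , tt)
      unnested : ∀ {A : Tup N (tup ts ∷ tup σ ∷ [])} {y} → A ∈ ⟦_⟧ N solutions (R , tt) → y ∈ proj₁ A →
                 Produces R (projT∈ outputColumns (appT N (tup ts ∷ tup σ ∷ []) ts A y))
      unnested {Y , S , tt} {y} A∈ y∈ = Y , S , y , A∈ , y∈ , projT∈-outputColumns Y S y
      produced : ∀ {z} → z ∈ ⟦_⟧ N nesting (R , tt) → Produces R z
      produced {z} z∈ = case ∈-map⁻ (projT∈ outputColumns) (subst (z ∈_) ⟦nesting⟧≡ z∈) of λ where
        (w , w∈ , refl) → case to (∈-⟦unnest⟧ zero refl solutions (R , tt)) w∈ of λ where
          (A , y , A∈ , y∈ , refl) → unnested A∈ y∈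
      produce : ∀ {z} → Produces R z → z ∈ ⟦_⟧ N nesting (R , tt)
      produce (Y , S , y , A∈ , y∈ , refl) =
        subst (_ ∈_) (sym ⟦nesting⟧≡) (subst (_∈ _) (projT∈-outputColumns Y S y) (∈-map⁺ (projT∈ outputColumns)
          (from (∈-⟦unnest⟧ zero refl solutions (R , tt)) ((Y , S , tt) , y , A∈ , y∈ , refl))))

    eqT-output : ∀ {x y : Tup N ts} {S S′} → y ≡ x → S ∼[ set ] S′ →
                 T (eqT N (ts ++ tup σ ∷ []) (appT N ts (tup σ ∷ []) y (S , tt)) (appT N ts (tup σ ∷ []) x (S′ , tt)))
    eqT-output refl S∼S′ = eqT-appT ts (tup σ ∷ []) (from (eqT⇔≡ fl) refl) (from T-∧ (from (eqV⇔∼set flσ) S∼S′ , tt))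

    nestedRow : List (Tup N ts) → Tup N ts → Tup N (ts ++ tup σ ∷ [])
    nestedRow R x = appT N ts (tup σ ∷ []) x (groupOf R x , tt)

    nesting-correct : ∀ R → T (eqV N (tup (ts ++ tup σ ∷ [])) (⟦_⟧ N nesting (R , tt)) (nestR N ts is R))
    nesting-correct R = eqV-tup⁺ (ts ++ tup σ ∷ []) sound complete
      where
      sound : ∀ {z} → z ∈ ⟦_⟧ N nesting (R , tt) → Any (T ∘ eqT N (ts ++ tup σ ∷ []) z) (map (nestedRow R) R)
      sound z∈ = case to (∈-⟦nesting⟧ {R}) z∈ of λ where
        (Y , S , y , A∈ , y∈ , refl) → case proj₂ (to (∈-⟦solutions⟧ {R} {Y} {S}) A∈) of λ where
          (x , x∈R , Y∼[x] , S∼) → lose (∈-map⁺ (nestedRow R) x∈R) (eqT-output (∈-singleton (to Y∼[x] y∈)) S∼)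
      complete : ∀ {z} → z ∈ map (nestedRow R) R → Any (T ∘ eqT N (ts ++ tup σ ∷ []) z) (⟦_⟧ N nesting (R , tt))
      complete z∈ = case ∈-map⁻ (nestedRow R) z∈ of λ where
        (x , x∈R , refl) → lose
          (from (∈-⟦nesting⟧ {R}) (canon (x ∷ []) , canon (groupOf R x) , x , canonicalSolution∈ x∈R ,
                                    from (canon-∼ fl (x ∷ [])) (here refl) , refl))
          (eqT-output refl (⇔.sym (canon-∼ flσ (groupOf R x))))

  solutions-Sparse : Sparse {ts ∷ []} (ts ∷ σ ∷ []) violations (violations ∖ violations)
  solutions-Sparse = (fl ∷ flσ ∷ []) , 1 , 1 , bound
    where
    bound : ∀ n (ρ : Env (suc n) (ts ∷ [])) → length (⟦_⟧ (suc n) solutions ρ) ≤ 1 * dbSize (suc n) (ts ∷ []) ρ ^ 1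
    bound n (R , tt) = begin
      length (⟦_⟧ (suc n) solutions (R , tt))       ≤⟨ Semantics.length-⟦solutions⟧ n R ⟩
      length R                                    ≤⟨ length≤sizeL ts R ⟩
      sizeL (suc n) ts R                          ≤⟨ m≤m+n _ 0 ⟩
      sizeL (suc n) ts R + 0                      ≤⟨ m≤n+m _ (suc n) ⟩
      dbSize (suc n) (ts ∷ []) (R , tt)           ≡⟨ sym (trans (*-identityˡ _) (^-identityʳ _)) ⟩
      1 * dbSize (suc n) (ts ∷ []) (R , tt) ^ 1   ∎
      where open ≤-Reasoning

  nesting-AllSparse : AllSparse nesting
  nesting-AllSparse = proj∈-preserves AllSparse outputColumns
    (solutions-Sparse , violations-AllSparse , violations-AllSparse , violations-AllSparse)

proposition7p5 : (ts : List Ty) → Flat ts → (is : List (Fin (length ts))) →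
    Σ (Expr (ts ∷ []) (ts ++ tup (map (lookup ts) is) ∷ [])) λ e →
      NoNest e × AllSparse e ×
      (∀ (n : ℕ) (R : List (Tup (suc n) ts)) →
        T (eqV (suc n) (tup (ts ++ tup (map (lookup ts) is) ∷ []))
               (⟦_⟧ (suc n) e (R , tt))
               (⟦_⟧ (suc n) (nest is (var (here refl))) (R , tt))))
proposition7p5 ts fl is = nesting , nesting-NoNest , nesting-AllSparse , λ n → Semantics.nesting-correct n
  where open Nesting fl is
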